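{- Let \(d \geq 2\) and let \(P \subset \mathbb{R}^d\) be a lattice polytope whose first two widths are \(w_1\) and \(w_2\). Then \(P\) is affine unimodularly equivalent to a subset of \([0,w_1]\times[0,w_2]\times\mathbb{R}^{d-2}\).
   Context: A lattice polytope is the convex hull of finitely many points of \(\mathbb{Z}^d\). Affine unimodular equivalence: maps \(x \mapsto Ax+b\) with \(A \in \mathrm{GL}_d(\mathbb{Z})\), \(b \in \mathbb{Z}^d\). For \(u \in (\mathbb{Z}^d)^*\), \(\mathrm{width}_u(P) = \max_{x\in P} u\cdot x - \min_{x\in P} u\cdot x\). The multi-width of \(P\) is the lexicographically minimal tuple \((\mathrm{width}_{u_1}(P),\dots,\mathrm{width}_{u_d}(P))\) over linearly independent \(u_1,\dots,u_d \in (\mathbb{Z}^d)^*\); its \(i\)-th entry is the \(i\)-th width of \(P\). -}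

module Defs where

open import Data.Nat using (ℕ; zero; suc)
open import Data.Fin using (Fin; zero; suc)
open import Data.Integer using (ℤ; _+_; _*_; _-_; _≤_; _<_; _⊔_; _⊓_; 0ℤ; 1ℤ)
open import Data.List.NonEmpty using (List⁺; foldr₁) renaming (map to map⁺)
open import Data.Product using (Σ; ∃; _×_; _,_)
open import Data.Sum using (_⊎_)
open import Relation.Binary.PropositionalEquality using (_≡_)

-- Points of ℤ^d and linear functionals in (ℤ^d)^*, both as functions Fin d → ℤ.
Pt : ℕ → Set
Pt d = Fin d → ℤ

sumFin : ∀ {d} → (Fin d → ℤ) → ℤ
sumFin {zero}  f = 0ℤ
sumFin {suc d} f = f zero + sumFin {d} (λ i → f (suc i))

_·_ : ∀ {d} → Pt d → Pt d → ℤ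
u · x = sumFin (λ i → u i * x i)

-- A lattice polytope P = conv(S) is given by a nonempty finite list S of lattice points.
-- width_u(P) = max_{x ∈ P} u·x − min_{x ∈ P} u·x; a linear functional attains its
-- max/min over conv(S) at points of S.
maxOn : ∀ {d} → Pt d → List⁺ (Pt d) → ℤ
maxOn u S = foldr₁ _⊔_ (map⁺ (u ·_) S)

minOn : ∀ {d} → Pt d → List⁺ (Pt d) → ℤ
minOn u S = foldr₁ _⊓_ (map⁺ (u ·_) S)

width : ∀ {d} → Pt d → List⁺ (Pt d) → ℤ
width u S = maxOn u S - minOn u S

LinIndep : ∀ {d} → (Fin d → Pt d) → Set
LinIndep {d} u = (c : Fin d → ℤ) → (∀ j → sumFin (λ i → c i * u i j) ≡ 0ℤ) → ∀ i → c i ≡ 0ℤ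

LexLe : ∀ {d} → (Fin d → ℤ) → (Fin d → ℤ) → Set
LexLe {zero}  a b = Data.Unit.⊤
  where import Data.Unit
LexLe {suc d} a b = (a zero < b zero) ⊎ ((a zero ≡ b zero) × LexLe (λ i → a (suc i)) (λ i → b (suc i)))

IsMultiWidth : ∀ {d} → List⁺ (Pt d) → (Fin d → ℤ) → Set
IsMultiWidth {d} S w =
  (Σ (Fin d → Pt d) λ u → LinIndep u × (∀ i → width (u i) S ≡ w i))
  × ((u : Fin d → Pt d) → LinIndep u → LexLe w (λ i → width (u i) S))

Mat : ℕ → Set
Mat d = Fin d → Fin d → ℤ

_⊗_ : ∀ {d} → Mat d → Mat d → Mat d
(A ⊗ B) i j = sumFin (λ k → A i k * B k j)

idMat : ∀ {d} → Mat d
idMat zero    zero    = 1ℤ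
idMat zero    (suc j) = 0ℤ
idMat (suc i) zero    = 0ℤ
idMat (suc i) (suc j) = idMat i j

InGL : ∀ {d} → Mat d → Set
InGL {d} A = Σ (Mat d) λ B → (∀ i j → (A ⊗ B) i j ≡ idMat i j) × (∀ i j → (B ⊗ A) i j ≡ idMat i j)

affine : ∀ {d} → Mat d → Pt d → Pt d → Pt d
affine A b x i = sumFin (λ k → A i k * x k) + b i

-- Let u₀, u₁ be linearly independent functionals attaining the first two widths; swapping
-- them shows w₀ ≤ w₁. Column operations (Euclid's algorithm) give a unimodular matrix with rows
-- m₀, m₁, … such that u₀ = g₀ m₀ and u₁ = r m₀ + g₁ m₁ with g₀, g₁ ≠ 0 and 0 ≤ r < |g₁|
-- (Hermite normal form of the 2 × d matrix with rows u₀, u₁). Widths are seminorms, so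
-- |g₀| width(m₀) ≤ w₀ and |g₁| width(m₁) ≤ w₁ + r width(m₀) ≤ (1 + r) w₁, whence
-- width(m₀) ≤ w₀ and width(m₁) ≤ w₁. Translating by the minima of m₀ and m₁ on P puts P
-- into [0, w₀] × [0, w₁] × ℝ^(d-2).
module Submission where

open import Defs
open import Function using (_∘_)
open import Data.Nat as ℕ using (ℕ; zero; suc; z≤n)
import Data.Nat.Properties as ℕP
open import Data.Fin using (Fin; zero; suc)
open import Data.Integer
  using (ℤ; +_; +[1+_]; -[1+_]; _+_; _*_; _-_; -_; ∣_∣; _≤_; _⊔_; _⊓_; 0ℤ; 1ℤ;
         _/_; _%_; NonZero; ≢-nonZero; positive; nonNegative; +<+; +≤+)
open import Data.Integer.Properties
open import Data.Integer.DivMod using (a≡a%n+[a/n]*n; n%d<d)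
open import Data.Integer.Tactic.RingSolver using (solve-∀)
open import Algebra.Properties.CommutativeSemigroup +-commutativeSemigroup
  using (interchange; x∙yz≈y∙xz)
open import Data.List using ([]; _∷_)
open import Data.List.NonEmpty using (List⁺; _∷_; toList; foldr₁) renaming (map to map⁺)
open import Data.List.Membership.Propositional using (_∈_)
open import Data.List.Relation.Unary.Any using (here; there)
open import Data.Product using (Σ; ∃; ∃₂; _×_; _,_; proj₂)
open import Data.Sum using (inj₁; inj₂)
open import Data.Vec.Functional using (tail) renaming (_∷_ to _∷ᵥ_)
open import Data.Vec.Functional.Properties using (∷-cong)
open import Relation.Binary.PropositionalEquality

sumFin-cong : ∀ {d} {f g : Fin d → ℤ} → f ≗ g → sumFin f ≡ sumFin g
sumFin-cong {zero}  _   = refl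
sumFin-cong {suc d} f≗g = cong₂ _+_ (f≗g zero) (sumFin-cong (f≗g ∘ suc))

sumFin-zero : ∀ {d} {f : Fin d → ℤ} → (∀ i → f i ≡ 0ℤ) → sumFin f ≡ 0ℤ
sumFin-zero {zero}  _   = refl
sumFin-zero {suc d} f≡0 = cong₂ _+_ (f≡0 zero) (sumFin-zero (f≡0 ∘ suc))

sumFin-distrib-+ : ∀ {d} (f g : Fin d → ℤ) → sumFin (λ i → f i + g i) ≡ sumFin f + sumFin g
sumFin-distrib-+ {zero}  _ _ = refl
sumFin-distrib-+ {suc d} f g =
  trans (cong (_+_ (f zero + g zero)) (sumFin-distrib-+ (f ∘ suc) (g ∘ suc)))
        (interchange (f zero) (g zero) (sumFin (f ∘ suc)) (sumFin (g ∘ suc)))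

*-distribˡ-sumFin : ∀ {d} c (f : Fin d → ℤ) → c * sumFin f ≡ sumFin (λ i → c * f i)
*-distribˡ-sumFin {zero}  c _ = *-zeroʳ c
*-distribˡ-sumFin {suc d} c f =
  trans (*-distribˡ-+ c (f zero) _) (cong (_+_ (c * f zero)) (*-distribˡ-sumFin c (f ∘ suc)))

*-distribʳ-sumFin : ∀ {d} c (f : Fin d → ℤ) → sumFin f * c ≡ sumFin (λ i → f i * c)
*-distribʳ-sumFin c f =
  trans (*-comm _ c) (trans (*-distribˡ-sumFin c f) (sumFin-cong (λ i → *-comm c (f i))))

sumFin-comm : ∀ {d e} (f : Fin d → Fin e → ℤ) →
  sumFin (λ k → sumFin (f k)) ≡ sumFin (λ l → sumFin (λ k → f k l))
sumFin-comm {zero} {e} _ = sym (sumFin-zero {e} {λ _ → 0ℤ} (λ _ → refl))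
sumFin-comm {suc d} f = trans (cong (_+_ (sumFin (f zero))) (sumFin-comm (f ∘ suc)))
                              (sym (sumFin-distrib-+ (f zero) _))

infixl 7 _⊙_

_⊙_ : ∀ {d} → Pt d → Mat d → Pt d
(v ⊙ A) j = sumFin (λ k → v k * A k j)

⊙-congˡ : ∀ {d} {v w : Pt d} (A : Mat d) → v ≗ w → v ⊙ A ≗ w ⊙ A
⊙-congˡ A v≗w j = sumFin-cong (λ k → cong (_* A k j) (v≗w k))

⊙-congʳ : ∀ {d} (v : Pt d) {A B : Mat d} → (∀ k → A k ≗ B k) → v ⊙ A ≗ v ⊙ B
⊙-congʳ v A≈B j = sumFin-cong (λ k → cong (v k *_) (A≈B k j))

⊙-identityʳ : ∀ {d} (v : Pt d) → v ⊙ idMat ≗ v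
⊙-identityʳ {suc d} v zero =
  trans (cong₂ _+_ (*-identityʳ (v zero)) (sumFin-zero (λ k → *-zeroʳ (v (suc k)))))
        (+-identityʳ _)
⊙-identityʳ {suc d} v (suc j) =
  trans (cong₂ _+_ (*-zeroʳ (v zero)) (⊙-identityʳ (tail v) j)) (+-identityˡ _)

⊙-⊗ : ∀ {d} (v : Pt d) (A B : Mat d) → (v ⊙ A) ⊙ B ≗ v ⊙ (A ⊗ B)
⊙-⊗ v A B j = begin
    sumFin (λ k → sumFin (λ l → v l * A l k) * B k j)
  ≡⟨ sumFin-cong (λ k → *-distribʳ-sumFin (B k j) (λ l → v l * A l k)) ⟩
    sumFin (λ k → sumFin (λ l → v l * A l k * B k j))
  ≡⟨ sumFin-comm (λ k l → v l * A l k * B k j) ⟩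
    sumFin (λ l → sumFin (λ k → v l * A l k * B k j))
  ≡⟨ sumFin-cong (λ l → trans (sumFin-cong (λ k → *-assoc (v l) (A l k) (B k j)))
                              (sym (*-distribˡ-sumFin (v l) (λ k → A l k * B k j)))) ⟩
    sumFin (λ l → v l * sumFin (λ k → A l k * B k j))
  ∎
  where open ≡-Reasoning

-- Row i of A ⊗ B is A i ⊙ B, so this says A ⊗ B = I.
RightInverse : ∀ {d} → Mat d → Mat d → Set
RightInverse A B = ∀ i → A i ⊙ B ≗ idMat i

⊗-rightInverse : ∀ {d} {A A′ B B′ : Mat d} →
  RightInverse A A′ → RightInverse B B′ → RightInverse (A ⊗ B) (B′ ⊗ A′)
⊗-rightInverse {A = A} {A′} {B} {B′} AA′ BB′ i j = begin
    (A i ⊙ B ⊙ (B′ ⊗ A′)) j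
  ≡⟨ ⊙-⊗ (A i ⊙ B) B′ A′ j ⟨
    (A i ⊙ B ⊙ B′ ⊙ A′) j
  ≡⟨ ⊙-congˡ A′ (λ k → trans (⊙-⊗ (A i) B B′ k)
                        (trans (⊙-congʳ (A i) BB′ k) (⊙-identityʳ (A i) k))) j ⟩
    (A i ⊙ A′) j
  ≡⟨ AA′ i j ⟩
    idMat i j
  ∎
  where open ≡-Reasoning

record GL (d : ℕ) : Set where
  field
    mat inv   : Mat d
    mat⊗inv≈I : RightInverse mat inv
    inv⊗mat≈I : RightInverse inv mat
open GL

idᴳ : ∀ {d} → GL d
idᴳ = record { mat = idMat ; inv = idMat
             ; mat⊗inv≈I = ⊙-identityʳ ∘ idMat ; inv⊗mat≈I = ⊙-identityʳ ∘ idMat }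

infixl 5 _⨾_

_⨾_ : ∀ {d} → GL d → GL d → GL d
K ⨾ L = record
  { mat = mat K ⊗ mat L ; inv = inv L ⊗ inv K
  ; mat⊗inv≈I = ⊗-rightInverse {A = mat K} {inv K} {mat L} {inv L} (mat⊗inv≈I K) (mat⊗inv≈I L)
  ; inv⊗mat≈I = ⊗-rightInverse {A = inv L} {mat L} {inv K} {mat K} (inv⊗mat≈I L) (inv⊗mat≈I K) }

⊙-⨾ : ∀ {d} (u : Pt d) (K L : GL d) {v w : Pt d} →
  u ⊙ mat K ≗ v → v ⊙ mat L ≗ w → u ⊙ mat (K ⨾ L) ≗ w
⊙-⨾ u K L u↦v v↦w j =
  trans (sym (⊙-⊗ u (mat K) (mat L) j)) (trans (⊙-congˡ (mat L) u↦v j) (v↦w j))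

⊙-inv : ∀ {d} (K : GL d) (v : Pt d) {w : Pt d} → v ⊙ mat K ≗ w → v ≗ w ⊙ inv K
⊙-inv K v {w} v↦w j = sym (begin
    (w ⊙ inv K) j                 ≡⟨ ⊙-congˡ (inv K) v↦w j ⟨
    (v ⊙ mat K ⊙ inv K) j         ≡⟨ ⊙-⊗ v (mat K) (inv K) j ⟩
    (v ⊙ (mat K ⊗ inv K)) j       ≡⟨ ⊙-congʳ v (mat⊗inv≈I K) j ⟩
    (v ⊙ idMat) j                 ≡⟨ ⊙-identityʳ v j ⟩
    v j                           ∎)
  where open ≡-Reasoning

axis₀ : ∀ {m} → ℤ → Pt (suc m)
axis₀ g = g ∷ᵥ λ _ → 0ℤ

plane : ∀ {m} → ℤ → ℤ → Pt (suc (suc m))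
plane a b = a ∷ᵥ axis₀ b

plane-cong : ∀ {m} {a a′ b b′ : ℤ} → a ≡ a′ → b ≡ b′ → plane {m} a b ≗ plane a′ b′
plane-cong a≡ b≡ = ∷-cong a≡ (∷-cong b≡ (λ _ → refl))

plane-axis₀ : ∀ {m} g → plane {m} g 0ℤ ≗ axis₀ g
plane-axis₀ g = ∷-cong refl (∷-cong refl (λ _ → refl))

plane-⊙ : ∀ {m} a b (A : Mat (suc (suc m))) j →
  (plane a b ⊙ A) j ≡ a * A zero j + b * A (suc zero) j
plane-⊙ a b A j = cong (_+_ (a * A zero j))
  (trans (cong (_+_ (b * A (suc zero) j))
                (sumFin-zero {f = λ k → 0ℤ * A (suc (suc k)) j} (λ _ → refl)))
         (+-identityʳ _))

1⊕_ : ∀ {d} → Mat d → Mat (suc d)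
(1⊕ A) zero    = axis₀ 1ℤ
(1⊕ A) (suc i) = 0ℤ ∷ᵥ A i

⊙-1⊕ : ∀ {d} (v : Pt (suc d)) (A : Mat d) → v ⊙ (1⊕ A) ≗ v zero ∷ᵥ (tail v ⊙ A)
⊙-1⊕ v A zero =
  trans (cong₂ _+_ (*-identityʳ (v zero)) (sumFin-zero (λ k → *-zeroʳ (v (suc k)))))
        (+-identityʳ _)
⊙-1⊕ v A (suc j) = trans (cong (_+ (tail v ⊙ A) j) (*-zeroʳ (v zero))) (+-identityˡ _)

1⊕-rightInverse : ∀ {d} {A B : Mat d} → RightInverse A B → RightInverse (1⊕ A) (1⊕ B)
1⊕-rightInverse {A = A} {B} AB zero    zero    = ⊙-1⊕ ((1⊕ A) zero) B zero
1⊕-rightInverse {A = A} {B} AB zero    (suc j) =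
  trans (⊙-1⊕ ((1⊕ A) zero) B (suc j)) (sumFin-zero {f = λ k → 0ℤ * B k j} (λ _ → refl))
1⊕-rightInverse {A = A} {B} AB (suc i) zero    = ⊙-1⊕ ((1⊕ A) (suc i)) B zero
1⊕-rightInverse {A = A} {B} AB (suc i) (suc j) = trans (⊙-1⊕ ((1⊕ A) (suc i)) B (suc j)) (AB i j)

1⊕ᴳ_ : ∀ {d} → GL d → GL (suc d)
1⊕ᴳ K = record { mat = 1⊕ mat K ; inv = 1⊕ inv K
               ; mat⊗inv≈I = 1⊕-rightInverse {A = mat K} {inv K} (mat⊗inv≈I K)
               ; inv⊗mat≈I = 1⊕-rightInverse {A = inv K} {mat K} (inv⊗mat≈I K) }

+-sumFin-*-zeroʳ : ∀ {d} (v : Pt d) x → x + sumFin (λ k → v k * 0ℤ) ≡ x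
+-sumFin-*-zeroʳ v x = trans (cong (_+_ x) (sumFin-zero (*-zeroʳ ∘ v))) (+-identityʳ x)

_⊕I : ∀ {m} → Mat 2 → Mat (suc (suc m))
(A ⊕I) zero          = plane (A zero zero) (A zero (suc zero))
(A ⊕I) (suc zero)    = plane (A (suc zero) zero) (A (suc zero) (suc zero))
(A ⊕I) (suc (suc i)) = 0ℤ ∷ᵥ 0ℤ ∷ᵥ idMat i

⊙-⊕I : ∀ {m} (v : Pt (suc (suc m))) (A : Mat 2) → v ⊙ (A ⊕I) ≗
  (v zero * A zero zero + v (suc zero) * A (suc zero) zero) ∷ᵥ
  (v zero * A zero (suc zero) + v (suc zero) * A (suc zero) (suc zero)) ∷ᵥ tail (tail v)
⊙-⊕I v A zero          =
  cong (_+_ (v zero * A zero zero)) (+-sumFin-*-zeroʳ (tail (tail v)) _)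
⊙-⊕I v A (suc zero)    =
  cong (_+_ (v zero * A zero (suc zero))) (+-sumFin-*-zeroʳ (tail (tail v)) _)
⊙-⊕I v A (suc (suc j)) =
  trans (zeros (v zero) (v (suc zero)) _) (⊙-identityʳ (tail (tail v)) j)
  where
  zeros : ∀ x y s → x * 0ℤ + (y * 0ℤ + s) ≡ s
  zeros = solve-∀

⊙₂ : (v : Pt 2) (B : Mat 2) (j : Fin 2) →
  (v ⊙ B) j ≡ v zero * B zero j + v (suc zero) * B (suc zero) j
⊙₂ v B j = cong (_+_ (v zero * B zero j)) (+-identityʳ _)

⊕I-rightInverse : ∀ {m} {A B : Mat 2} → RightInverse A B → RightInverse {suc (suc m)} (A ⊕I) (B ⊕I)
⊕I-rightInverse {m} {A} {B} AB = rows
  where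
  entry : ∀ i j → A i zero * B zero j + A i (suc zero) * B (suc zero) j ≡ idMat i j
  entry i j = trans (sym (⊙₂ (A i) B j)) (AB i j)
  row : Fin (suc (suc m)) → Pt (suc (suc m))
  row = A ⊕I
  rows : RightInverse (A ⊕I) (B ⊕I)
  rows zero          zero          = trans (⊙-⊕I (row zero) B zero) (entry zero zero)
  rows zero          (suc zero)    = trans (⊙-⊕I (row zero) B (suc zero)) (entry zero (suc zero))
  rows zero          (suc (suc j)) = ⊙-⊕I (row zero) B (suc (suc j))
  rows (suc zero)    zero          = trans (⊙-⊕I (row (suc zero)) B zero) (entry (suc zero) zero)
  rows (suc zero)    (suc zero)    =
    trans (⊙-⊕I (row (suc zero)) B (suc zero)) (entry (suc zero) (suc zero))
  rows (suc zero)    (suc (suc j)) = ⊙-⊕I (row (suc zero)) B (suc (suc j))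
  rows (suc (suc i)) zero          = ⊙-⊕I (row (suc (suc i))) B zero
  rows (suc (suc i)) (suc zero)    = ⊙-⊕I (row (suc (suc i))) B (suc zero)
  rows (suc (suc i)) (suc (suc j)) = ⊙-⊕I (row (suc (suc i))) B (suc (suc j))

_⊕Iᴳ : ∀ {m} → GL 2 → GL (suc (suc m))
K ⊕Iᴳ = record { mat = mat K ⊕I ; inv = inv K ⊕I
               ; mat⊗inv≈I = ⊕I-rightInverse {A = mat K} {inv K} (mat⊗inv≈I K)
               ; inv⊗mat≈I = ⊕I-rightInverse {A = inv K} {mat K} (inv⊗mat≈I K) }

mat₂ : ℤ → ℤ → ℤ → ℤ → Mat 2
mat₂ a b c d zero       zero       = a
mat₂ a b c d zero       (suc zero) = b
mat₂ a b c d (suc zero) zero       = c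
mat₂ a b c d (suc zero) (suc zero) = d

shear : ℤ → GL 2
shear k = record
  { mat = mat₂ 1ℤ 0ℤ k 1ℤ ; inv = mat₂ 1ℤ 0ℤ (- k) 1ℤ
  ; mat⊗inv≈I = λ { zero zero → refl ; zero (suc zero) → refl
                  ; (suc zero) zero → cancel k
                  ; (suc zero) (suc zero) → cong (_+ 1ℤ) (*-zeroʳ k) }
  ; inv⊗mat≈I = λ { zero zero → refl ; zero (suc zero) → refl
                  ; (suc zero) zero → cancel′ k
                  ; (suc zero) (suc zero) → cong (_+ 1ℤ) (*-zeroʳ (- k)) } }
  where
  cancel : ∀ k → k * 1ℤ + (1ℤ * - k + 0ℤ) ≡ 0ℤ
  cancel = solve-∀
  cancel′ : ∀ k → - k * 1ℤ + (1ℤ * k + 0ℤ) ≡ 0ℤ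
  cancel′ = solve-∀

swap : GL 2
swap = record { mat = mat₂ 0ℤ 1ℤ 1ℤ 0ℤ ; inv = mat₂ 0ℤ 1ℤ 1ℤ 0ℤ
              ; mat⊗inv≈I = λ { zero zero → refl ; zero (suc zero) → refl
                              ; (suc zero) zero → refl ; (suc zero) (suc zero) → refl }
              ; inv⊗mat≈I = λ { zero zero → refl ; zero (suc zero) → refl
                              ; (suc zero) zero → refl ; (suc zero) (suc zero) → refl } }

⊙-shear : ∀ {m} x y k → plane {m} x y ⊙ mat (shear k ⊕Iᴳ) ≗ plane (x + y * k) y
⊙-shear x y k j =
  trans (⊙-⊕I (plane x y) (mat (shear k)) j) (plane-cong (x*1+y*k≡x+y*k x y k) (x*0+y*1≡y x y) j)
  where
  x*1+y*k≡x+y*k : ∀ x y k → x * 1ℤ + y * k ≡ x + y * k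
  x*1+y*k≡x+y*k = solve-∀
  x*0+y*1≡y : ∀ x y → x * 0ℤ + y * 1ℤ ≡ y
  x*0+y*1≡y = solve-∀

⊙-swap : ∀ {m} x y → plane {m} x y ⊙ mat (swap ⊕Iᴳ) ≗ plane y x
⊙-swap x y j = trans (⊙-⊕I (plane x y) (mat swap) j) (plane-cong (x*0+y*1≡y x y) (x*1+y*0≡x x y) j)
  where
  x*1+y*0≡x : ∀ x y → x * 1ℤ + y * 0ℤ ≡ x
  x*1+y*0≡x = solve-∀
  x*0+y*1≡y : ∀ x y → x * 0ℤ + y * 1ℤ ≡ y
  x*0+y*1≡y = solve-∀

a+b*-[a/b]≡a%b : ∀ a b .{{_ : NonZero b}} → a + b * - (a / b) ≡ + (a % b)
a+b*-[a/b]≡a%b a b =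
  trans (cong (_+ b * - (a / b)) (a≡a%n+[a/n]*n a b)) (cancel (+ (a % b)) (a / b) b)
  where
  cancel : ∀ r q b → r + q * b + b * - q ≡ r
  cancel = solve-∀


euclid-step : ∀ {m} a b .{{_ : NonZero b}} →
  ∃₂ (λ (K : GL (suc (suc m))) g → plane b (+ (a % b)) ⊙ mat K ≗ plane g 0ℤ) →
  ∃₂ (λ (K : GL (suc (suc m))) g → plane a b ⊙ mat K ≗ plane g 0ℤ)
euclid-step a b (K , g , reduced) =
  shear q ⊕Iᴳ ⨾ swap ⊕Iᴳ ⨾ K , g ,
  ⊙-⨾ (plane a b) (shear q ⊕Iᴳ ⨾ swap ⊕Iᴳ) K
    (⊙-⨾ (plane a b) (shear q ⊕Iᴳ) (swap ⊕Iᴳ)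
      (λ j → trans (⊙-shear a b q j) (plane-cong (a+b*-[a/b]≡a%b a b) (refl {x = b}) j))
      (⊙-swap (+ (a % b)) b))
    reduced
  where
  q = - (a / b)

%-bound : ∀ {f} a b .{{_ : NonZero b}} → ∣ b ∣ ℕ.≤ suc f → a % b ℕ.≤ f
%-bound a b ∣b∣≤ = ℕ.s≤s⁻¹ (ℕP.≤-trans (n%d<d a b) ∣b∣≤)

euclid : ∀ {m} (f : ℕ) a b → ∣ b ∣ ℕ.≤ f →
  ∃₂ (λ (K : GL (suc (suc m))) g → plane a b ⊙ mat K ≗ plane g 0ℤ)
euclid _       a (+ 0)          _    = idᴳ , a , ⊙-identityʳ _
euclid zero    a +[1+ _ ]       ()
euclid zero    a -[1+ _ ]       ()
euclid (suc f) a b@(+[1+ _ ]) ∣b∣≤ = euclid-step a b (euclid f b (+ (a % b)) (%-bound a b ∣b∣≤))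
euclid (suc f) a b@(-[1+ _ ]) ∣b∣≤ = euclid-step a b (euclid f b (+ (a % b)) (%-bound a b ∣b∣≤))

reduceToAxis : ∀ {m} (v : Pt (suc m)) → ∃₂ λ (K : GL (suc m)) g → v ⊙ mat K ≗ axis₀ g
reduceToAxis {zero} v = idᴳ , v zero , λ { zero → ⊙-identityʳ v zero }
reduceToAxis {suc m} v with reduceToAxis (tail v)
... | K , g , tail↦g with euclid ∣ g ∣ (v zero) g ℕP.≤-refl
... | L , h , plane↦h =
  1⊕ᴳ K ⨾ L , h , ⊙-⨾ v (1⊕ᴳ K) L toPlane (λ j → trans (plane↦h j) (plane-axis₀ h j))
  where
  toPlane : v ⊙ mat (1⊕ᴳ K) ≗ plane (v zero) g
  toPlane zero    = ⊙-1⊕ v (mat K) zero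
  toPlane (suc j) = trans (⊙-1⊕ v (mat K) (suc j)) (tail↦g j)

·-linear : ∀ {d} {v p q : Pt d} {a b : ℤ} →
  (∀ j → v j ≡ a * p j + b * q j) → ∀ z → v · z ≡ a * (p · z) + b * (q · z)
·-linear {v = v} {p} {q} {a} {b} v≡ z = begin
    sumFin (λ i → v i * z i)
  ≡⟨ sumFin-cong (λ i → trans (cong (_* z i) (v≡ i)) (distribute a b (p i) (q i) (z i))) ⟩
    sumFin (λ i → a * (p i * z i) + b * (q i * z i))
  ≡⟨ sumFin-distrib-+ (λ i → a * (p i * z i)) (λ i → b * (q i * z i)) ⟩
    sumFin (λ i → a * (p i * z i)) + sumFin (λ i → b * (q i * z i))
  ≡⟨ cong₂ _+_ (*-distribˡ-sumFin a (λ i → p i * z i)) (*-distribˡ-sumFin b (λ i → q i * z i)) ⟨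
    a * (p · z) + b * (q · z)
  ∎
  where
  open ≡-Reasoning
  distribute : ∀ a b p q z → (a * p + b * q) * z ≡ a * (p * z) + b * (q * z)
  distribute = solve-∀

⊙-inv-plane : ∀ {m} (K : GL (suc (suc m))) (v : Pt (suc (suc m))) {a b : ℤ} →
  v ⊙ mat K ≗ plane a b → ∀ z → v · z ≡ a * (inv K zero · z) + b * (inv K (suc zero) · z)
⊙-inv-plane K v {a} {b} v↦ = ·-linear {p = inv K zero} {inv K (suc zero)} {a} {b}
  (λ j → trans (⊙-inv K v v↦ j) (plane-⊙ a b (inv K) j))

Independent₂ : ∀ {d} → Pt d → Pt d → Set
Independent₂ u₀ u₁ = ∀ a b → (∀ j → a * u₀ j + b * u₁ j ≡ 0ℤ) → a ≡ 0ℤ × b ≡ 0ℤ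

linIndep⇒independent₂ : ∀ {n} {u : Fin (suc (suc n)) → Pt (suc (suc n))} →
  LinIndep u → Independent₂ (u zero) (u (suc zero))
linIndep⇒independent₂ {u = u} indep a b comb≡0 = coefficients zero , coefficients (suc zero)
  where
  coefficients = indep (plane a b) (λ j → trans (plane-⊙ a b u j) (comb≡0 j))

record LowerTriangular {n} (u₀ u₁ : Pt (suc (suc n))) : Set where
  field
    K        : GL (suc (suc n))
    g₀ t g₁  : ℤ
    u₀⊙K     : u₀ ⊙ mat K ≗ plane g₀ 0ℤ
    u₁⊙K     : u₁ ⊙ mat K ≗ plane t g₁

-- Opaque: conversion checks that unfold Euclid's algorithm exhaust memory.
opaque
  triangularize : ∀ {n} (u₀ u₁ : Pt (suc (suc n))) → LowerTriangular u₀ u₁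
  triangularize u₀ u₁ with reduceToAxis u₀
  ... | K , g₀ , u₀↦g₀ with reduceToAxis (tail (u₁ ⊙ mat K))
  ... | L , g₁ , tail↦g₁ = record
    { K = K ⨾ 1⊕ᴳ L ; g₀ = g₀ ; t = (u₁ ⊙ mat K) zero ; g₁ = g₁
    ; u₀⊙K = ⊙-⨾ u₀ K (1⊕ᴳ L) u₀↦g₀ axis₀-fixed
    ; u₁⊙K = ⊙-⨾ u₁ K (1⊕ᴳ L) (λ _ → refl) tail-reduced }
    where
    offAxis : ∀ j → (axis₀ g₀ ⊙ mat (1⊕ᴳ L)) (suc j) ≡ 0ℤ
    offAxis j =
      trans (⊙-1⊕ (axis₀ g₀) (mat L) (suc j)) (sumFin-zero {f = λ k → 0ℤ * mat L k j} (λ _ → refl))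
    axis₀-fixed : axis₀ g₀ ⊙ mat (1⊕ᴳ L) ≗ plane g₀ 0ℤ
    axis₀-fixed zero          = ⊙-1⊕ (axis₀ g₀) (mat L) zero
    axis₀-fixed (suc zero)    = offAxis zero
    axis₀-fixed (suc (suc j)) = offAxis (suc j)
    tail-reduced : u₁ ⊙ mat K ⊙ mat (1⊕ᴳ L) ≗ plane ((u₁ ⊙ mat K) zero) g₁
    tail-reduced zero    = ⊙-1⊕ (u₁ ⊙ mat K) (mat L) zero
    tail-reduced (suc j) = trans (⊙-1⊕ (u₁ ⊙ mat K) (mat L) (suc j)) (tail↦g₁ j)

record HermiteForm₂ {n} (u₀ u₁ : Pt (suc (suc n))) : Set where
  field
    K       : GL (suc (suc n))
    g₀ g₁   : ℤ
    r       : ℕ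
    0<∣g₀∣  : 0 ℕ.< ∣ g₀ ∣
    r<∣g₁∣  : r ℕ.< ∣ g₁ ∣
    u₀⊙K    : u₀ ⊙ mat K ≗ plane g₀ 0ℤ
    u₁⊙K    : u₁ ⊙ mat K ≗ plane (+ r) g₁

opaque
  hermiteForm₂ : ∀ {n} {u₀ u₁ : Pt (suc (suc n))} → Independent₂ u₀ u₁ → HermiteForm₂ u₀ u₁
  hermiteForm₂ {n} {u₀} {u₁} indep = record
    { K = K ⨾ shear q ⊕Iᴳ ; g₀ = g₀ ; g₁ = g₁ ; r = t % g₁
    ; 0<∣g₀∣ = ℕP.n≢0⇒n>0 (g₀≢0 ∘ ∣i∣≡0⇒i≡0)
    ; r<∣g₁∣ = n%d<d t g₁
    ; u₀⊙K = ⊙-⨾ u₀ K (shear q ⊕Iᴳ) u₀⊙K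
               (λ j → trans (⊙-shear g₀ 0ℤ q j)
                            (plane-cong (+-identityʳ g₀) (refl {x = 0ℤ}) j))
    ; u₁⊙K = ⊙-⨾ u₁ K (shear q ⊕Iᴳ) u₁⊙K
               (λ j → trans (⊙-shear t g₁ q j)
                            (plane-cong (a+b*-[a/b]≡a%b t g₁) (refl {x = g₁}) j)) }
    where
    open LowerTriangular (triangularize u₀ u₁)
    m₀ m₁ : Pt (suc (suc n))
    m₀ = inv K zero
    m₁ = inv K (suc zero)
    u₀≡ : ∀ j → u₀ j ≡ g₀ * m₀ j + 0ℤ * m₁ j
    u₀≡ j = trans (⊙-inv K u₀ u₀⊙K j) (plane-⊙ g₀ 0ℤ (inv K) j)
    u₁≡ : ∀ j → u₁ j ≡ t * m₀ j + g₁ * m₁ j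
    u₁≡ j = trans (⊙-inv K u₁ u₁⊙K j) (plane-⊙ t g₁ (inv K) j)
    g₀≢0 : g₀ ≢ 0ℤ
    g₀≢0 g₀≡0 with indep 1ℤ 0ℤ (λ j →
      cong (λ x → 1ℤ * x + 0ℤ * u₁ j) (trans (u₀≡ j) (cong (λ g → g * m₀ j + 0ℤ) g₀≡0)))
    ... | () , _
    -- With g₁ = 0 both u₀ and u₁ are multiples of m₀, so t u₀ − g₀ u₁ = 0.
    g₁≢0 : g₁ ≢ 0ℤ
    g₁≢0 g₁≡0 = g₀≢0 (neg-injective (proj₂ (indep t (- g₀) λ j → begin
        t * u₀ j + - g₀ * u₁ j
      ≡⟨ cong₂ (λ x y → t * x + - g₀ * y)
               (u₀≡ j) (trans (u₁≡ j) (cong (λ g → t * m₀ j + g * m₁ j) g₁≡0)) ⟩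
        t * (g₀ * m₀ j + 0ℤ) + - g₀ * (t * m₀ j + 0ℤ)
      ≡⟨ cancel t g₀ (m₀ j) ⟩
        0ℤ
      ∎)))
      where
      open ≡-Reasoning
      cancel : ∀ t g x → t * (g * x + 0ℤ) + - g * (t * x + 0ℤ) ≡ 0ℤ
      cancel = solve-∀
    instance
      g₁-nonZero : NonZero g₁
      g₁-nonZero = ≢-nonZero g₁≢0
    q : ℤ
    q = - (t / g₁)

module _ {A : Set} (f : A → ℤ) where

  ≤-foldr₁-⊔ : ∀ {xs : List⁺ A} {x} → x ∈ toList xs → f x ≤ foldr₁ _⊔_ (map⁺ f xs)
  ≤-foldr₁-⊔ {a ∷ []}    (here refl) = ≤-refl
  ≤-foldr₁-⊔ {a ∷ b ∷ l} (here refl) = i≤i⊔j _ _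
  ≤-foldr₁-⊔ {a ∷ b ∷ l} (there x∈)  = ≤-trans (≤-foldr₁-⊔ {b ∷ l} x∈) (i≤j⊔i _ _)

  foldr₁-⊓-≤ : ∀ {xs : List⁺ A} {x} → x ∈ toList xs → foldr₁ _⊓_ (map⁺ f xs) ≤ f x
  foldr₁-⊓-≤ {a ∷ []}    (here refl) = ≤-refl
  foldr₁-⊓-≤ {a ∷ b ∷ l} (here refl) = i⊓j≤i _ _
  foldr₁-⊓-≤ {a ∷ b ∷ l} (there x∈)  = ≤-trans (i⊓j≤j _ _) (foldr₁-⊓-≤ {b ∷ l} x∈)

  foldr₁-⊔-attained : ∀ a l → ∃ λ x → x ∈ toList (a ∷ l) × foldr₁ _⊔_ (map⁺ f (a ∷ l)) ≡ f x
  foldr₁-⊔-attained a []      = a , here refl , refl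
  foldr₁-⊔-attained a (b ∷ l) with ⊔-sel (f a) (foldr₁ _⊔_ (map⁺ f (b ∷ l))) | foldr₁-⊔-attained b l
  ... | inj₁ max≡fa   | _               = a , here refl , max≡fa
  ... | inj₂ max≡rest | x , x∈ , rest≡fx = x , there x∈ , trans max≡rest rest≡fx

  foldr₁-⊓-attained : ∀ a l → ∃ λ x → x ∈ toList (a ∷ l) × foldr₁ _⊓_ (map⁺ f (a ∷ l)) ≡ f x
  foldr₁-⊓-attained a []      = a , here refl , refl
  foldr₁-⊓-attained a (b ∷ l) with ⊓-sel (f a) (foldr₁ _⊓_ (map⁺ f (b ∷ l))) | foldr₁-⊓-attained b l
  ... | inj₁ min≡fa   | _               = a , here refl , min≡fa
  ... | inj₂ min≡rest | x , x∈ , rest≡fx = x , there x∈ , trans min≡rest rest≡fx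

diff≤width : ∀ {d} (S : List⁺ (Pt d)) (u : Pt d) {x y} → x ∈ toList S → y ∈ toList S →
  u · x - u · y ≤ width u S
diff≤width S u x∈ y∈ = +-mono-≤ (≤-foldr₁-⊔ (u ·_) x∈) (neg-mono-≤ (foldr₁-⊓-≤ (u ·_) y∈))

width-attained : ∀ {d} (S : List⁺ (Pt d)) (u : Pt d) →
  ∃₂ λ x y → x ∈ toList S × y ∈ toList S × width u S ≡ u · x - u · y
width-attained (a ∷ l) u with foldr₁-⊔-attained (u ·_) a l | foldr₁-⊓-attained (u ·_) a l
... | x , x∈ , max≡ | y , y∈ , min≡ = x , y , x∈ , y∈ , cong₂ _-_ max≡ min≡

0≤width : ∀ {d} (S : List⁺ (Pt d)) (u : Pt d) → 0ℤ ≤ width u S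
0≤width S@(a ∷ _) u =
  subst (_≤ width u S) (+-inverseʳ (u · a)) (diff≤width S u (here refl) (here refl))

shifted-bounds : ∀ {d} (S : List⁺ (Pt d)) (u : Pt d) {x W} → x ∈ toList S → width u S ≤ W →
  (0ℤ ≤ u · x - minOn u S) × (u · x - minOn u S ≤ W)
shifted-bounds S u x∈ width≤W =
  i≤j⇒0≤j-i (foldr₁-⊓-≤ (u ·_) x∈) ,
  ≤-trans (+-monoˡ-≤ (- minOn u S) (≤-foldr₁-⊔ (u ·_) x∈)) width≤W

∣c∣*[a-b]≤ : ∀ c a b {B} → c * (a - b) ≤ B → c * (b - a) ≤ B → + ∣ c ∣ * (a - b) ≤ B
∣c∣*[a-b]≤ (+ n)      a b c[a-b]≤B _        = c[a-b]≤B
∣c∣*[a-b]≤ -[1+ n ]   a b _        c[b-a]≤B = subst (_≤ _) (sym (flip +[1+ n ] a b)) c[b-a]≤B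
  where
  flip : ∀ k a b → k * (a - b) ≡ - k * (b - a)
  flip = solve-∀

scaled-width-bound : ∀ {d} (S : List⁺ (Pt d)) (u p m : Pt d) (r : ℕ) (c : ℤ) →
  (∀ z → u · z ≡ + r * (p · z) + c * (m · z)) →
  + ∣ c ∣ * width m S ≤ width u S + + r * width p S
scaled-width-bound S u p m r c u≡ with width-attained S m
... | x , y , x∈ , y∈ , width≡ =
  subst (_≤ _) (sym (cong (+ ∣ c ∣ *_) width≡))
    (∣c∣*[a-b]≤ c (m · x) (m · y) (pair-bound x∈ y∈) (pair-bound y∈ x∈))
  where
  pair-bound : ∀ {x y} → x ∈ toList S → y ∈ toList S →
    c * (m · x - m · y) ≤ width u S + + r * width p S
  pair-bound {x} {y} x∈ y∈ = begin
      c * (m · x - m · y)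
    ≡⟨ difference (+ r) c (p · x) (p · y) (m · x) (m · y) ⟩
      (+ r * (p · x) + c * (m · x)) - (+ r * (p · y) + c * (m · y)) + + r * (p · y - p · x)
    ≡⟨ cong₂ (λ ux uy → ux - uy + + r * (p · y - p · x)) (u≡ x) (u≡ y) ⟨
      (u · x - u · y) + + r * (p · y - p · x)
    ≤⟨ +-mono-≤ (diff≤width S u x∈ y∈) (*-monoˡ-≤-nonNeg (+ r) (diff≤width S p y∈ x∈)) ⟩
      width u S + + r * width p S
    ∎
    where
    open ≤-Reasoning
    difference : ∀ r c px py mx my →
      c * (mx - my) ≡ (r * px + c * mx) - (r * py + c * my) + r * (py - px)
    difference = solve-∀

width-reduction : ∀ {d} (S : List⁺ (Pt d)) (u p m : Pt d) {r : ℕ} {c : ℤ} → r ℕ.< ∣ c ∣ →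
  (∀ z → u · z ≡ + r * (p · z) + c * (m · z)) → width p S ≤ width u S → width m S ≤ width u S
width-reduction S u p m {r} {c} r<∣c∣ u≡ wp≤wu =
  *-cancelˡ-≤-pos (width m S) (width u S) (+ ∣ c ∣) {{positive (+<+ (ℕP.≤-<-trans z≤n r<∣c∣))}}
  (begin
      + ∣ c ∣ * width m S
    ≤⟨ scaled-width-bound S u p m r c u≡ ⟩
      width u S + + r * width p S
    ≤⟨ +-monoʳ-≤ (width u S) (*-monoˡ-≤-nonNeg (+ r) wp≤wu) ⟩
      width u S + + r * width u S
    ≡⟨ suc-* (+ r) (width u S) ⟨
      + suc r * width u S
    ≤⟨ *-monoʳ-≤-nonNeg (width u S) {{nonNegative (0≤width S u)}} (+≤+ r<∣c∣) ⟩
      + ∣ c ∣ * width u S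
    ∎)
  where open ≤-Reasoning

LexLe-head : ∀ {d} {a b : Fin (suc d) → ℤ} → LexLe a b → a zero ≤ b zero
LexLe-head (inj₁ a₀<b₀)     = <⇒≤ a₀<b₀
LexLe-head (inj₂ (a₀≡b₀ , _)) = ≤-reflexive a₀≡b₀

swap₀₁ : ∀ {n} {A : Set} → (Fin (suc (suc n)) → A) → Fin (suc (suc n)) → A
swap₀₁ f zero          = f (suc zero)
swap₀₁ f (suc zero)    = f zero
swap₀₁ f (suc (suc i)) = f (suc (suc i))

linIndep-swap₀₁ : ∀ {n} {u : Fin (suc (suc n)) → Pt (suc (suc n))} →
  LinIndep u → LinIndep (swap₀₁ u)
linIndep-swap₀₁ {u = u} indep c comb≡0 =
  unswap (indep (swap₀₁ c) (λ j → trans (exchange j) (comb≡0 j)))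
  where
  exchange : ∀ j → sumFin (λ i → swap₀₁ c i * u i j) ≡ sumFin (λ i → c i * swap₀₁ u i j)
  exchange j = x∙yz≈y∙xz (c (suc zero) * u zero j) (c zero * u (suc zero) j)
                         (sumFin (λ i → c (suc (suc i)) * u (suc (suc i)) j))
  unswap : (∀ i → swap₀₁ c i ≡ 0ℤ) → ∀ i → c i ≡ 0ℤ
  unswap c′≡0 zero          = c′≡0 (suc zero)
  unswap c′≡0 (suc zero)    = c′≡0 zero
  unswap c′≡0 (suc (suc i)) = c′≡0 (suc (suc i))

multiWidth-w₀≤w₁ : ∀ {n} {S : List⁺ (Pt (suc (suc n)))} {w : Fin (suc (suc n)) → ℤ} →
  IsMultiWidth S w → w zero ≤ w (suc zero)
multiWidth-w₀≤w₁ {S = S} {w} ((u , indep , width≡w) , lexMinimal) =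
  subst (w zero ≤_) (width≡w (suc zero))
    (LexLe-head {a = w} {b = λ i → width (swap₀₁ u i) S}
      (lexMinimal (swap₀₁ u) (linIndep-swap₀₁ {u = u} indep)))

proposition2p1 : (n : ℕ) (S : List⁺ (Pt (suc (suc n)))) (w : Fin (suc (suc n)) → ℤ) →
    IsMultiWidth S w →
    Σ (Mat (suc (suc n))) λ A → InGL A × Σ (Pt (suc (suc n))) λ b →
      ((x : Pt (suc (suc n))) → x ∈ toList S →
        (0ℤ ≤ affine A b x zero) × (affine A b x zero ≤ w zero)
        × (0ℤ ≤ affine A b x (suc zero)) × (affine A b x (suc zero) ≤ w (suc zero)))
proposition2p1 n S w multiWidth@((u , indep , width≡w) , _) =
  inv K , (mat K , inv⊗mat≈I K , mat⊗inv≈I K) , (λ i → - minOn (inv K i) S) , inBox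
  where
  open HermiteForm₂
    (hermiteForm₂ {u₀ = u zero} {u (suc zero)} (linIndep⇒independent₂ {u = u} indep))
  m₀ m₁ : Pt (suc (suc n))
  m₀ = inv K zero
  m₁ = inv K (suc zero)
  w₀≤w₁ : w zero ≤ w (suc zero)
  w₀≤w₁ = multiWidth-w₀≤w₁ {S = S} multiWidth
  width-m₀ : width m₀ S ≤ w zero
  width-m₀ = subst (width m₀ S ≤_) (width≡w zero)
    (width-reduction S (u zero) (u zero) m₀ {0} {g₀} 0<∣g₀∣
      (λ z → trans (⊙-inv-plane K (u zero) u₀⊙K z) (+-comm (g₀ * (m₀ · z)) 0ℤ)) ≤-refl)
  width-m₁ : width m₁ S ≤ w (suc zero)
  width-m₁ = subst (width m₁ S ≤_) (width≡w (suc zero))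
    (width-reduction S (u (suc zero)) m₀ m₁ {r} {g₁} r<∣g₁∣ (⊙-inv-plane K (u (suc zero)) u₁⊙K)
      (≤-trans width-m₀ (≤-trans w₀≤w₁ (≤-reflexive (sym (width≡w (suc zero)))))))
  inBox : (x : Pt (suc (suc n))) → x ∈ toList S →
    (0ℤ ≤ m₀ · x - minOn m₀ S) × (m₀ · x - minOn m₀ S ≤ w zero)
    × (0ℤ ≤ m₁ · x - minOn m₁ S) × (m₁ · x - minOn m₁ S ≤ w (suc zero))
  inBox x x∈ =
    let lo₀ , hi₀ = shifted-bounds S m₀ {x} x∈ width-m₀
        lo₁ , hi₁ = shifted-bounds S m₁ {x} x∈ width-m₁
    in  lo₀ , hi₀ , lo₁ , hi₁
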